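{- Let $d\ge 1$ and let $n_1,\dots,n_d$ be positive integers. Then, as $t\to\infty$, \[\pi_t^*(K_{n_1}\Box K_{n_2}\Box\cdots\Box K_{n_d})\in 2^d t\prod_{i=1}^d\frac{n_i}{n_i+1}+\Theta(1),\] i.e. the difference $\pi_t^*(K_{n_1}\Box\cdots\Box K_{n_d})-2^d t\prod_{i=1}^d\frac{n_i}{n_i+1}$ is bounded by a constant independent of $t$.
   Context: A distribution on a graph $G=(V,E)$ is a function $D:V\to\mathbb{N}$, with size $|D|=\sum_v D(v)$. A pebbling move removes two pebbles from a vertex having at least two pebbles and places one pebble on a neighbor. A distribution $D$ is $t$-solvable if for every vertex $v$, some sequence of pebbling moves starting from $D$ results in a distribution with at least $t$ pebbles on $v$. The optimal $t$-pebbling number $\pi_t^*(G)$ is the minimum size of a $t$-solvable distribution on $G$. $K_n$ is the complete graph on $n$ vertices and $\Box$ is the Cartesian product of graphs. -}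

module Defs where

open import Data.Nat using (ℕ; zero; suc; _+_; _*_; _^_; _≤_; _<_)
open import Data.Fin using (Fin)
open import Data.List using (List; []; _∷_; length; map; concatMap; allFin)
open import Data.Nat.ListAction using (sum; product)
open import Data.Unit using (⊤; tt)
open import Data.Empty using (⊥)
open import Data.Product using (Σ; _×_; _,_; ∃; ∃-syntax)
open import Data.Sum using (_⊎_)
open import Relation.Binary.PropositionalEquality using (_≡_; _≢_)
open import Relation.Binary.Construct.Closure.ReflexiveTransitive using (Star)

-- Vertices of K_{n_1} □ K_{n_2} □ ... □ K_{n_d}, for ns = n_1 ∷ ... ∷ n_d ∷ [].
Vertex : List ℕ → Set
Vertex []       = ⊤
Vertex (n ∷ ns) = Fin n × Vertex ns

allVertices : (ns : List ℕ) → List (Vertex ns)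
allVertices []       = tt ∷ []
allVertices (n ∷ ns) = concatMap (λ a → map (λ v → (a , v)) (allVertices ns)) (allFin n)

Adj : (ns : List ℕ) → Vertex ns → Vertex ns → Set
Adj []       _       _       = ⊥
Adj (n ∷ ns) (a , u) (b , v) = (a ≢ b × u ≡ v) ⊎ (a ≡ b × Adj ns u v)

Distribution : List ℕ → Set
Distribution ns = Vertex ns → ℕ

size : (ns : List ℕ) → Distribution ns → ℕ
size ns D = sum (map D (allVertices ns))

Move : (ns : List ℕ) → Distribution ns → Distribution ns → Set
Move ns D D' =
  Σ (Vertex ns) λ u → Σ (Vertex ns) λ v →
    Adj ns u v × D u ≡ 2 + D' u × D' v ≡ suc (D v) ×
    (∀ w → w ≢ u → w ≢ v → D' w ≡ D w)

Reachable : (ns : List ℕ) → Distribution ns → Distribution ns → Set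
Reachable ns = Star (Move ns)

Solvable : (ns : List ℕ) → ℕ → Distribution ns → Set
Solvable ns t D = ∀ v → ∃[ D' ] (Reachable ns D D' × t ≤ D' v)

IsOptPebbling : (ns : List ℕ) → ℕ → ℕ → Set
IsOptPebbling ns t p =
  (∃[ D ] (Solvable ns t D × size ns D ≡ p)) ×
  (∀ D → Solvable ns t D → p ≤ size ns D)

productSuc : List ℕ → ℕ
productSuc ns = product (map suc ns)

-- For a fixed target v, weight each vertex w by 2^(number of coordinates in which w agrees with v).
-- The endpoints of an edge differ in one coordinate, so their weights differ by a factor of at most 2:
-- a pebbling move (lose two pebbles at u, gain one at a neighbour) never increases the weighted total.
-- A t-solvable distribution therefore has weighted total at least 2^d t for every v.  Summing over v,
-- each vertex w has total weight ∏ (n_i + 1) (each coordinate contributes 2 + (n_i − 1)), whence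
-- ∏ (n_i + 1) · |D| ≥ 2^d t ∏ n_i.
--
-- Conversely, 2^d m pebbles on every vertex can put m ∏ (n_i + 1) pebbles on any vertex (c, v):
-- by induction on d, with ∏' = ∏_{i ≥ 2} (n_i + 1), first collect 2 m ∏' on (c, v) inside the layer
-- of c, then collect 2 m ∏' on (b, v) in each of the other n_1 − 1 layers b and move half of it to
-- (c, v).  Taking m = ⌈t / ∏ (n_i + 1)⌉ gives the matching upper bound up to the additive
-- constant 2^d ∏ n_i.
--
-- The optimum exists because solvability is decidable: every move loses a pebble, so the reachable
-- distributions can be searched exhaustively, and there are finitely many distributions of each size.

module Submission where

open import Data.Empty using (⊥-elim)
open import Data.Fin using (Fin; zero; suc; punchIn; toℕ; fromℕ<)
import Data.Fin.Properties as Fin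
open import Data.Integer using (+_; _-_; ∣_∣)
import Data.Integer.Properties as ℤ
open import Data.List using (List; []; _∷_; _++_; length; map; concatMap; allFin; tabulate)
import Data.List.Properties as List
open import Data.List.Relation.Unary.All using (All)
import Data.List.Relation.Unary.All as All
import Data.List.Relation.Unary.All.Properties as All
open import Data.Nat using (ℕ; zero; suc; _+_; _*_; _^_; _≤_; _<_; _∸_; z≤n; s≤s; NonZero)
open import Data.Nat.DivMod using (_/_; _%_; m≡m%n+[m/n]*n; m%n≤n; m/n*n≤m)
open import Data.Nat.ListAction using (product)
import Data.Nat.ListAction as List
open import Data.Nat.ListAction.Properties using (sum-++; product≢0)
open import Data.Nat.Properties
open import Data.Nat.Tactic.RingSolver using (solve-∀)
open import Data.Product using (_×_; _,_; ∃; ∃-syntax; proj₁; proj₂; map₁)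
open import Data.Product.Properties using (≡-dec)
open import Data.Sum using (inj₁; inj₂)
open import Data.Unit using (tt)
import Data.Unit.Properties as Unit
open import Data.Vec using (Vec; []; _∷_)
import Data.Vec as Vec
import Data.Vec.Properties as Vec
open import Function using (_∘_)
open import Function.Definitions using (Injective)
open import Relation.Binary.Construct.Closure.ReflexiveTransitive using (ε; _◅_; _◅◅_)
open import Relation.Binary.Definitions using (DecidableEquality; _Respects_)
open import Relation.Binary.PropositionalEquality
open import Relation.Nullary using (Dec; yes; no; ¬_; ¬?; _×-dec_; _⊎-dec_; map′)
open import Relation.Nullary.Decidable using (decidable-stable)
open import Relation.Unary using (Decidable)

open import Algebra.Properties.CommutativeSemigroup *-commutativeSemigroup using (x∙yz≈y∙xz)
open import Algebra.Properties.Semiring.Sum +-*-semiring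
  using (sum; sum-syntax; sum-cong-≗; sum-remove; sum-replicate-zero; ∑-distrib-+; ∑-comm; *-distribˡ-sum)

open import Defs

sum-const : ∀ n k → ∑[ i < n ] k ≡ n * k
sum-const zero    k = refl
sum-const (suc n) k = cong (_+_ k) (sum-const n k)

sum-mono-≤ : ∀ {n} {f g : Fin n → ℕ} → (∀ i → f i ≤ g i) → sum f ≤ sum g
sum-mono-≤ {zero}  f≤g = z≤n
sum-mono-≤ {suc n} f≤g = +-mono-≤ (f≤g zero) (sum-mono-≤ (f≤g ∘ suc))

f≤sum : ∀ {n} (f : Fin n → ℕ) i → f i ≤ sum f
f≤sum {suc n} f i = ≤-trans (m≤m+n (f i) _) (≤-reflexive (sym (sum-remove f)))

sum-single : ∀ {n} (f : Fin n → ℕ) i → (∀ j → j ≢ i → f j ≡ 0) → sum f ≡ f i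
sum-single {suc n} f i zero-off = begin
  sum f                         ≡⟨ sum-remove f ⟩
  f i + sum (f ∘ punchIn i)     ≡⟨ cong (_+_ (f i)) (sum-cong-≗ {n} (λ j → zero-off _ (Fin.punchInᵢ≢i i j))) ⟩
  f i + ∑[ j < n ] 0            ≡⟨ cong (_+_ (f i)) (sum-replicate-zero n) ⟩
  f i + 0                       ≡⟨ +-identityʳ (f i) ⟩
  f i                           ∎
  where open ≡-Reasoning

∑V : (ns : List ℕ) → (Vertex ns → ℕ) → ℕ
∑V []       f = f tt
∑V (n ∷ ns) f = ∑[ a < n ] ∑V ns (λ v → f (a , v))

∑V-cong : ∀ ns {f g : Vertex ns → ℕ} → f ≗ g → ∑V ns f ≡ ∑V ns g
∑V-cong []       f≗g = f≗g tt
∑V-cong (n ∷ ns) f≗g = sum-cong-≗ {n} (λ a → ∑V-cong ns (λ v → f≗g (a , v)))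

∑V-mono-≤ : ∀ ns {f g : Vertex ns → ℕ} → (∀ v → f v ≤ g v) → ∑V ns f ≤ ∑V ns g
∑V-mono-≤ []       f≤g = f≤g tt
∑V-mono-≤ (n ∷ ns) f≤g = sum-mono-≤ (λ a → ∑V-mono-≤ ns (λ v → f≤g (a , v)))

∑V-distrib-+ : ∀ ns (f g : Vertex ns → ℕ) → ∑V ns (λ v → f v + g v) ≡ ∑V ns f + ∑V ns g
∑V-distrib-+ []       f g = refl
∑V-distrib-+ (n ∷ ns) f g =
  trans (sum-cong-≗ {n} (λ a → ∑V-distrib-+ ns _ _))
        (∑-distrib-+ (λ a → ∑V ns (λ v → f (a , v))) (λ a → ∑V ns (λ v → g (a , v))))

*-distribˡ-∑V : ∀ ns k (f : Vertex ns → ℕ) → k * ∑V ns f ≡ ∑V ns (λ v → k * f v)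
*-distribˡ-∑V []       k f = refl
*-distribˡ-∑V (n ∷ ns) k f =
  trans (*-distribˡ-sum k (λ a → ∑V ns (λ v → f (a , v))))
        (sum-cong-≗ {n} (λ a → *-distribˡ-∑V ns k _))

∑V-const : ∀ ns k → ∑V ns (λ _ → k) ≡ product ns * k
∑V-const []       k = sym (+-identityʳ k)
∑V-const (n ∷ ns) k = begin
  ∑[ a < n ] ∑V ns (λ _ → k) ≡⟨ sum-cong-≗ {n} (λ _ → ∑V-const ns k) ⟩
  ∑[ a < n ] (product ns * k) ≡⟨ sum-const n _ ⟩
  n * (product ns * k)       ≡⟨ *-assoc n _ k ⟨
  n * product ns * k         ∎
  where open ≡-Reasoning

∑V-single : ∀ ns (f : Vertex ns → ℕ) u → (∀ w → w ≢ u → f w ≡ 0) → ∑V ns f ≡ f u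
∑V-single []       f tt       zero-off = refl
∑V-single (n ∷ ns) f (a , u) zero-off = begin
  ∑[ b < n ] ∑V ns (λ v → f (b , v)) ≡⟨ sum-single _ a (λ b b≢a → ∑V-zero b b≢a) ⟩
  ∑V ns (λ v → f (a , v))            ≡⟨ ∑V-single ns _ u (λ w w≢u → zero-off _ (w≢u ∘ cong proj₂)) ⟩
  f (a , u)                          ∎
  where
  open ≡-Reasoning
  ∑V-zero : ∀ b → b ≢ a → ∑V ns (λ v → f (b , v)) ≡ 0
  ∑V-zero b b≢a = trans (∑V-cong ns (λ v → zero-off _ (b≢a ∘ cong proj₁)))
                        (trans (∑V-const ns 0) (*-zeroʳ (product ns)))

f≤∑V : ∀ ns (f : Vertex ns → ℕ) u → f u ≤ ∑V ns f
f≤∑V []       f tt      = ≤-refl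
f≤∑V (n ∷ ns) f (a , u) =
  ≤-trans (f≤∑V ns (λ v → f (a , v)) u) (f≤sum (λ b → ∑V ns (λ v → f (b , v))) a)

sum-∑V-comm : ∀ n ms (g : Fin n → Vertex ms → ℕ) →
  ∑[ a < n ] ∑V ms (g a) ≡ ∑V ms (λ w → ∑[ a < n ] g a w)
sum-∑V-comm n []       g = refl
sum-∑V-comm n (m ∷ ms) g = begin
  ∑[ a < n ] ∑[ b < m ] ∑V ms (λ w → g a (b , w)) ≡⟨ ∑-comm (λ a b → ∑V ms (λ w → g a (b , w))) ⟩
  ∑[ b < m ] ∑[ a < n ] ∑V ms (λ w → g a (b , w)) ≡⟨ sum-cong-≗ {m} (λ b → sum-∑V-comm n ms (λ a w → g a (b , w))) ⟩
  ∑[ b < m ] ∑V ms (λ w → ∑[ a < n ] g a (b , w)) ∎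
  where open ≡-Reasoning

∑V-comm : ∀ ns ms (g : Vertex ns → Vertex ms → ℕ) →
  ∑V ns (λ v → ∑V ms (g v)) ≡ ∑V ms (λ w → ∑V ns (λ v → g v w))
∑V-comm []       ms g = refl
∑V-comm (n ∷ ns) ms g =
  trans (sum-cong-≗ {n} (λ a → ∑V-comm ns ms (λ v → g (a , v))))
        (sum-∑V-comm n ms (λ a w → ∑V ns (λ v → g (a , v) w)))

sum-map-concatMap : ∀ {A B : Set} (D : B → ℕ) (F : A → List B) (xs : List A) →
  List.sum (map D (concatMap F xs)) ≡ List.sum (map (λ x → List.sum (map D (F x))) xs)
sum-map-concatMap D F []       = refl
sum-map-concatMap D F (x ∷ xs) = begin
  List.sum (map D (F x ++ concatMap F xs))
    ≡⟨ cong List.sum (List.map-++ D (F x) _) ⟩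
  List.sum (map D (F x) ++ map D (concatMap F xs))
    ≡⟨ sum-++ (map D (F x)) _ ⟩
  List.sum (map D (F x)) + List.sum (map D (concatMap F xs))
    ≡⟨ cong (_+_ (List.sum (map D (F x)))) (sum-map-concatMap D F xs) ⟩
  List.sum (map D (F x)) + List.sum (map (λ x → List.sum (map D (F x))) xs)
    ∎
  where open ≡-Reasoning

sum-tabulate : ∀ n (g : Fin n → ℕ) → List.sum (tabulate g) ≡ ∑[ a < n ] g a
sum-tabulate zero    g = refl
sum-tabulate (suc n) g = cong (_+_ (g zero)) (sum-tabulate n (g ∘ suc))

sum-map-allFin : ∀ n (g : Fin n → ℕ) → List.sum (map g (allFin n)) ≡ ∑[ a < n ] g a
sum-map-allFin n g = trans (cong List.sum (List.map-tabulate (λ a → a) g)) (sum-tabulate n g)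

size≡∑V : ∀ ns (D : Distribution ns) → size ns D ≡ ∑V ns D
size≡∑V []       D = +-identityʳ (D tt)
size≡∑V (n ∷ ns) D = begin
  List.sum (map D (concatMap (λ a → map (a ,_) (allVertices ns)) (allFin n)))
    ≡⟨ sum-map-concatMap D _ (allFin n) ⟩
  List.sum (map (λ a → List.sum (map D (map (a ,_) (allVertices ns)))) (allFin n))
    ≡⟨ cong List.sum (List.map-cong (λ a → cong List.sum (sym (List.map-∘ (allVertices ns)))) (allFin n)) ⟩
  List.sum (map (λ a → size ns (λ v → D (a , v))) (allFin n))
    ≡⟨ sum-map-allFin n _ ⟩
  ∑[ a < n ] size ns (λ v → D (a , v))
    ≡⟨ sum-cong-≗ {n} (λ a → size≡∑V ns _) ⟩
  ∑[ a < n ] ∑V ns (λ v → D (a , v))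
    ∎
  where open ≡-Reasoning

_≟V_ : ∀ {ns} → DecidableEquality (Vertex ns)
_≟V_ {[]}     = Unit._≟_
_≟V_ {n ∷ ns} = ≡-dec Fin._≟_ _≟V_

𝟙 : ∀ {P : Set} → Dec P → ℕ
𝟙 (yes _) = 1
𝟙 (no _)  = 0

𝟙-yes : ∀ {P : Set} (d : Dec P) → P → 𝟙 d ≡ 1
𝟙-yes (yes _) _ = refl
𝟙-yes (no ¬p) p = ⊥-elim (¬p p)

𝟙-no : ∀ {P : Set} (d : Dec P) → ¬ P → 𝟙 d ≡ 0
𝟙-no (yes p) ¬p = ⊥-elim (¬p p)
𝟙-no (no _)  _  = refl

𝟙≤1 : ∀ {P : Set} (d : Dec P) → 𝟙 d ≤ 1
𝟙≤1 (yes _) = ≤-refl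
𝟙≤1 (no _)  = z≤n

sum-𝟙 : ∀ {n} (b : Fin n) (f : Fin n → ℕ) → ∑[ a < n ] (𝟙 (a Fin.≟ b) * f a) ≡ f b
sum-𝟙 b f = trans (sum-single _ b (λ a a≢b → cong (_* f a) (𝟙-no (a Fin.≟ b) a≢b)))
                  (trans (cong (_* f b) (𝟙-yes (b Fin.≟ b) refl)) (+-identityʳ (f b)))

∑V-𝟙 : ∀ ns u (f : Vertex ns → ℕ) → ∑V ns (λ w → 𝟙 (w ≟V u) * f w) ≡ f u
∑V-𝟙 ns u f = trans (∑V-single ns _ u (λ w w≢u → cong (_* f w) (𝟙-no (w ≟V u) w≢u)))
                    (trans (cong (_* f u) (𝟙-yes (u ≟V u) refl)) (+-identityʳ (f u)))

Adj-irrefl : ∀ ns {u : Vertex ns} → ¬ Adj ns u u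
Adj-irrefl (n ∷ ns) (inj₁ (a≢a , _)) = a≢a refl
Adj-irrefl (n ∷ ns) (inj₂ (_ , adj)) = Adj-irrefl ns adj

Adj⇒≢ : ∀ ns {u v : Vertex ns} → Adj ns u v → u ≢ v
Adj⇒≢ ns adj refl = Adj-irrefl ns adj

Adj? : ∀ ns (u v : Vertex ns) → Dec (Adj ns u v)
Adj? []       _       _       = no λ ()
Adj? (n ∷ ns) (a , u) (b , v) = (¬? (a Fin.≟ b) ×-dec u ≟V v) ⊎-dec (a Fin.≟ b ×-dec Adj? ns u v)

move-pointwise : ∀ ns {D D'} (m : Move ns D D') → let (u , x , _) = m in
  ∀ w → D' w + 2 * 𝟙 (w ≟V u) ≡ D w + 𝟙 (w ≟V x)
move-pointwise ns {D} {D'} (u , x , adj , Du≡2+D'u , D'x≡1+Dx , unchanged) w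
  with w ≟V u | w ≟V x
... | yes refl | yes refl = ⊥-elim (Adj-irrefl ns adj)
... | yes refl | no _     = trans (+-comm (D' w) 2) (trans (sym Du≡2+D'u) (sym (+-identityʳ (D w))))
... | no _     | yes refl = trans (+-identityʳ (D' w)) (trans D'x≡1+Dx (+-comm 1 (D w)))
... | no w≢u   | no w≢x   = trans (+-identityʳ (D' w)) (trans (unchanged w w≢u w≢x) (sym (+-identityʳ (D w))))

weighted : ∀ ns → Distribution ns → (Vertex ns → ℕ) → ℕ
weighted ns D c = ∑V ns (λ w → D w * c w)

weighted-move : ∀ ns {D D'} (m : Move ns D D') (c : Vertex ns → ℕ) → let (u , x , _) = m in
  weighted ns D' c + 2 * c u ≡ weighted ns D c + c x
weighted-move ns {D} {D'} m@(u , x , _) c = begin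
  weighted ns D' c + 2 * c u
    ≡⟨ cong (λ e → weighted ns D' c + 2 * e) (∑V-𝟙 ns u c) ⟨
  weighted ns D' c + 2 * ∑V ns (λ w → 𝟙 (w ≟V u) * c w)
    ≡⟨ cong (_+_ (weighted ns D' c)) (*-distribˡ-∑V ns 2 _) ⟩
  weighted ns D' c + ∑V ns (λ w → 2 * (𝟙 (w ≟V u) * c w))
    ≡⟨ ∑V-distrib-+ ns _ _ ⟨
  ∑V ns (λ w → D' w * c w + 2 * (𝟙 (w ≟V u) * c w))
    ≡⟨ ∑V-cong ns (λ w → trans (distribute (D' w) (𝟙 (w ≟V u)) (c w))
                                (cong (_* c w) (move-pointwise ns m w))) ⟩
  ∑V ns (λ w → (D w + 𝟙 (w ≟V x)) * c w)
    ≡⟨ ∑V-cong ns (λ w → *-distribʳ-+ (c w) (D w) _) ⟩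
  ∑V ns (λ w → D w * c w + 𝟙 (w ≟V x) * c w)
    ≡⟨ ∑V-distrib-+ ns _ _ ⟩
  weighted ns D c + ∑V ns (λ w → 𝟙 (w ≟V x) * c w)
    ≡⟨ cong (_+_ (weighted ns D c)) (∑V-𝟙 ns x c) ⟩
  weighted ns D c + c x ∎
  where
  open ≡-Reasoning
  distribute : ∀ a e c → a * c + 2 * (e * c) ≡ (a + 2 * e) * c
  distribute = solve-∀

∑V-move : ∀ ns {D D'} → Move ns D D' → suc (∑V ns D') ≡ ∑V ns D
∑V-move ns {D} {D'} m = +-cancelʳ-≡ 1 _ _ (begin
  suc (∑V ns D') + 1           ≡⟨ +-comm (suc (∑V ns D')) 1 ⟩
  2 + ∑V ns D'                 ≡⟨ +-comm 2 (∑V ns D') ⟩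
  ∑V ns D' + 2                 ≡⟨ cong (_+ 2) (∑V-cong ns (λ w → *-identityʳ (D' w))) ⟨
  weighted ns D' (λ _ → 1) + 2 ≡⟨ weighted-move ns m (λ _ → 1) ⟩
  weighted ns D (λ _ → 1) + 1  ≡⟨ cong (_+ 1) (∑V-cong ns (λ w → *-identityʳ (D w))) ⟩
  ∑V ns D + 1                  ∎)
  where open ≡-Reasoning

weight : ∀ ns → Vertex ns → Vertex ns → ℕ
weight []       _       _       = 1
weight (n ∷ ns) (a , v) (b , w) = suc (𝟙 (a Fin.≟ b)) * weight ns v w

weight-diag : ∀ ns (v : Vertex ns) → weight ns v v ≡ 2 ^ length ns
weight-diag []       tt      = refl
weight-diag (n ∷ ns) (a , v) = cong₂ (λ e f → suc e * f) (𝟙-yes (a Fin.≟ a) refl) (weight-diag ns v)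

weight-adj : ∀ ns v {u x : Vertex ns} → Adj ns u x → weight ns v x ≤ 2 * weight ns v u
weight-adj (n ∷ ns) (c , v) {a , u} {b , .u} (inj₁ (_ , refl)) = begin
  suc (𝟙 (c Fin.≟ b)) * weight ns v u       ≤⟨ *-monoˡ-≤ (weight ns v u) (s≤s (𝟙≤1 (c Fin.≟ b))) ⟩
  2 * weight ns v u                          ≤⟨ *-monoʳ-≤ 2 (m≤m+n (weight ns v u) _) ⟩
  2 * (suc (𝟙 (c Fin.≟ a)) * weight ns v u) ∎
  where open ≤-Reasoning
weight-adj (n ∷ ns) (c , v) {a , u} {.a , x} (inj₂ (refl , adj)) = begin
  suc (𝟙 (c Fin.≟ a)) * weight ns v x         ≤⟨ *-monoʳ-≤ (suc (𝟙 (c Fin.≟ a))) (weight-adj ns v adj) ⟩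
  suc (𝟙 (c Fin.≟ a)) * (2 * weight ns v u)   ≡⟨ x∙yz≈y∙xz (suc (𝟙 (c Fin.≟ a))) 2 (weight ns v u) ⟩
  2 * (suc (𝟙 (c Fin.≟ a)) * weight ns v u)   ∎
  where open ≤-Reasoning

∑V-weight : ∀ ns (w : Vertex ns) → ∑V ns (λ v → weight ns v w) ≡ productSuc ns
∑V-weight []       tt      = refl
∑V-weight (n ∷ ns) (b , w) = begin
  ∑[ a < n ] ∑V ns (λ v → suc (𝟙 (a Fin.≟ b)) * weight ns v w)
    ≡⟨ sum-cong-≗ {n} (λ a → scaled (suc (𝟙 (a Fin.≟ b)))) ⟩
  ∑[ a < n ] (P + 𝟙 (a Fin.≟ b) * P)
    ≡⟨ ∑-distrib-+ (λ _ → P) (λ a → 𝟙 (a Fin.≟ b) * P) ⟩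
  ∑[ a < n ] P + ∑[ a < n ] (𝟙 (a Fin.≟ b) * P)
    ≡⟨ cong₂ _+_ (sum-const n P) (sum-𝟙 b (λ _ → P)) ⟩
  n * P + P
    ≡⟨ +-comm (n * P) P ⟩
  suc n * P ∎
  where
  open ≡-Reasoning
  P = productSuc ns
  scaled : ∀ k → ∑V ns (λ v → k * weight ns v w) ≡ k * P
  scaled k = trans (sym (*-distribˡ-∑V ns k _)) (cong (_*_ k) (∑V-weight ns w))

potential : ∀ ns → Vertex ns → Distribution ns → ℕ
potential ns v D = weighted ns D (weight ns v)

potential-move : ∀ ns v {D D'} → Move ns D D' → potential ns v D' ≤ potential ns v D
potential-move ns v {D} {D'} m@(u , x , adj , _) = +-cancelʳ-≤ (2 * weight ns v u) _ _ (begin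
  potential ns v D' + 2 * weight ns v u ≡⟨ weighted-move ns m (weight ns v) ⟩
  potential ns v D + weight ns v x      ≤⟨ +-monoʳ-≤ (potential ns v D) (weight-adj ns v adj) ⟩
  potential ns v D + 2 * weight ns v u  ∎)
  where open ≤-Reasoning

potential-reachable : ∀ ns v {D D'} → Reachable ns D D' → potential ns v D' ≤ potential ns v D
potential-reachable ns v ε       = ≤-refl
potential-reachable ns v (m ◅ r) = ≤-trans (potential-reachable ns v r) (potential-move ns v m)

potential-solvable : ∀ ns t {D} → Solvable ns t D → ∀ v → 2 ^ length ns * t ≤ potential ns v D
potential-solvable ns t {D} solvable v with solvable v
... | D' , D⇒D' , t≤D'v = begin
  2 ^ length ns * t          ≤⟨ *-monoʳ-≤ (2 ^ length ns) t≤D'v ⟩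
  2 ^ length ns * D' v       ≡⟨ *-comm (2 ^ length ns) (D' v) ⟩
  D' v * 2 ^ length ns       ≡⟨ cong (D' v *_) (weight-diag ns v) ⟨
  D' v * weight ns v v       ≤⟨ f≤∑V ns (λ w → D' w * weight ns v w) v ⟩
  potential ns v D'          ≤⟨ potential-reachable ns v D⇒D' ⟩
  potential ns v D           ∎
  where open ≤-Reasoning

solvable⇒size-lowerBound : ∀ ns t {D} → Solvable ns t D →
  2 ^ length ns * t * product ns ≤ productSuc ns * size ns D
solvable⇒size-lowerBound ns t {D} solvable = begin
  2 ^ length ns * t * product ns
    ≡⟨ *-comm _ (product ns) ⟩
  product ns * (2 ^ length ns * t)
    ≡⟨ ∑V-const ns _ ⟨
  ∑V ns (λ _ → 2 ^ length ns * t)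
    ≤⟨ ∑V-mono-≤ ns (potential-solvable ns t solvable) ⟩
  ∑V ns (λ v → ∑V ns (λ w → D w * weight ns v w))
    ≡⟨ ∑V-comm ns ns _ ⟩
  ∑V ns (λ w → ∑V ns (λ v → D w * weight ns v w))
    ≡⟨ ∑V-cong ns (λ w → *-distribˡ-∑V ns (D w) _) ⟨
  ∑V ns (λ w → D w * ∑V ns (λ v → weight ns v w))
    ≡⟨ ∑V-cong ns (λ w → trans (cong (D w *_) (∑V-weight ns w)) (*-comm (D w) _)) ⟩
  ∑V ns (λ w → productSuc ns * D w)
    ≡⟨ *-distribˡ-∑V ns (productSuc ns) D ⟨
  productSuc ns * ∑V ns D
    ≡⟨ cong (productSuc ns *_) (size≡∑V ns D) ⟨
  productSuc ns * size ns D
    ∎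
  where open ≤-Reasoning

infix 4 _⊢_⇝_

_⊢_⇝_ : ∀ ns → Distribution ns → (Distribution ns → Set) → Set
ns ⊢ D ⇝ P = ∃[ E ] (Reachable ns D E × P E)

⇝-here : ∀ {ns D} {P : Distribution ns → Set} → P D → ns ⊢ D ⇝ P
⇝-here p = _ , ε , p

⇝-bind : ∀ {ns D} {P Q : Distribution ns → Set} →
  ns ⊢ D ⇝ P → (∀ {E} → P E → ns ⊢ E ⇝ Q) → ns ⊢ D ⇝ Q
⇝-bind (E , D⇒E , p) k with k p
... | F , E⇒F , q = F , D⇒E ◅◅ E⇒F , q

⇝-map : ∀ {ns D} {P Q : Distribution ns → Set} → (∀ {E} → P E → Q E) → ns ⊢ D ⇝ P → ns ⊢ D ⇝ Q
⇝-map f (E , D⇒E , p) = E , D⇒E , f p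

⇝-move : ∀ {ns D D'} {P : Distribution ns → Set} → Move ns D D' → ns ⊢ D' ⇝ P → ns ⊢ D ⇝ P
⇝-move m (E , D'⇒E , p) = E , m ◅ D'⇒E , p

move-respˡ : ∀ ns {D D' X} → D ≗ D' → Move ns D X → Move ns D' X
move-respˡ ns D≗D' (u , x , adj , Du≡2+Xu , Xx≡1+Dx , unchanged) =
  u , x , adj , trans (sym (D≗D' u)) Du≡2+Xu , trans Xx≡1+Dx (cong suc (D≗D' x)) ,
  λ w w≢u w≢x → trans (unchanged w w≢u w≢x) (D≗D' w)

reachable-respˡ : ∀ ns {D D' X} → D ≗ D' → Reachable ns D X → ∃[ X' ] (Reachable ns D' X' × X' ≗ X)
reachable-respˡ ns D≗D' ε       = _ , ε , sym ∘ D≗D'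
reachable-respˡ ns D≗D' (m ◅ r) = _ , move-respˡ ns D≗D' m ◅ r , λ _ → refl

step : ∀ {ns} → Distribution ns → Vertex ns → Vertex ns → Distribution ns
step D x y w with w ≟V x
... | yes _ = D x ∸ 2
... | no _ with w ≟V y
...   | yes _ = suc (D y)
...   | no _  = D w

step-source : ∀ {ns} (D : Distribution ns) x y → step D x y x ≡ D x ∸ 2
step-source D x y with x ≟V x
... | yes _   = refl
... | no x≢x  = ⊥-elim (x≢x refl)

step-target : ∀ {ns} (D : Distribution ns) {x y} → y ≢ x → step D x y y ≡ suc (D y)
step-target D {x} {y} y≢x with y ≟V x
... | yes y≡x = ⊥-elim (y≢x y≡x)
... | no _ with y ≟V y
...   | yes _   = refl
...   | no y≢y  = ⊥-elim (y≢y refl)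

step-other : ∀ {ns} (D : Distribution ns) {x y w} → w ≢ x → w ≢ y → step D x y w ≡ D w
step-other D {x} {y} {w} w≢x w≢y with w ≟V x
... | yes w≡x = ⊥-elim (w≢x w≡x)
... | no _ with w ≟V y
...   | yes w≡y = ⊥-elim (w≢y w≡y)
...   | no _    = refl

step-move : ∀ ns {D x y} → Adj ns x y → 2 ≤ D x → Move ns D (step D x y)
step-move ns {D} {x} {y} adj 2≤Dx =
  x , y , adj ,
  trans (sym (m+[n∸m]≡n 2≤Dx)) (cong (_+_ 2) (sym (step-source D x y))) ,
  step-target D (Adj⇒≢ ns adj ∘ sym) ,
  λ w w≢x w≢y → step-other D w≢x w≢y

move≗step : ∀ ns {D D'} (m : Move ns D D') → let (u , x , _) = m in D' ≗ step D u x
move≗step ns {D} {D'} (u , x , adj , Du≡2+D'u , D'x≡1+Dx , unchanged) w = by-cases (w ≟V u) (w ≟V x)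
  where
  by-cases : Dec (w ≡ u) → Dec (w ≡ x) → D' w ≡ step D u x w
  by-cases (yes refl) _ =
    trans (sym (m+n∸m≡n 2 (D' w))) (trans (cong (_∸ 2) (sym Du≡2+D'u)) (sym (step-source D w x)))
  by-cases (no w≢u) (yes refl) = trans D'x≡1+Dx (sym (step-target D w≢u))
  by-cases (no w≢u) (no w≢x)   = trans (unchanged w w≢u w≢x) (sym (step-other D w≢u w≢x))

transfer : ∀ ns k {D x y} → Adj ns x y → 2 * k ≤ D x →
  ns ⊢ D ⇝ (λ E → k + D y ≤ E y × (∀ w → w ≢ x → D w ≤ E w))
transfer ns zero    adj _     = ⇝-here (≤-refl , λ _ _ → ≤-refl)
transfer ns (suc k) {D} {x} {y} adj 2+2k≤Dx =
  ⇝-move (step-move ns adj 2≤Dx)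
    (⇝-map (λ (k+D₁y≤Ey , grown) → ≤-trans (≤-reflexive 1+k+Dy≡k+D₁y) k+D₁y≤Ey
                                  , λ w w≢x → ≤-trans (step-grows w w≢x) (grown w w≢x))
           (transfer ns k adj 2k≤))
  where
  2≤Dx : 2 ≤ D x
  2≤Dx = ≤-trans (≤-trans (m≤m+n 2 (2 * k)) (≤-reflexive (sym (*-suc 2 k)))) 2+2k≤Dx
  1+k+Dy≡k+D₁y : suc k + D y ≡ k + step D x y y
  1+k+Dy≡k+D₁y = trans (sym (+-suc k (D y))) (cong (_+_ k) (sym (step-target D (Adj⇒≢ ns adj ∘ sym))))
  2k≤ : 2 * k ≤ step D x y x
  2k≤ = begin
    2 * k                 ≡⟨ m+n∸m≡n 2 (2 * k) ⟨
    2 + 2 * k ∸ 2         ≡⟨ cong (_∸ 2) (*-suc 2 k) ⟨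
    2 * suc k ∸ 2         ≤⟨ ∸-monoˡ-≤ 2 2+2k≤Dx ⟩
    D x ∸ 2               ≡⟨ step-source D x y ⟨
    step D x y x          ∎
    where open ≤-Reasoning
  step-grows : ∀ w → w ≢ x → D w ≤ step D x y w
  step-grows w w≢x with w ≟V y
  ... | yes refl = ≤-trans (n≤1+n (D w)) (≤-reflexive (sym (step-target D w≢x)))
  ... | no w≢y   = ≤-reflexive (sym (step-other D w≢x w≢y))

KeepsOtherLayers : ∀ {n ns} → Fin n → Distribution (n ∷ ns) → Distribution (n ∷ ns) → Set
KeepsOtherLayers a D E = ∀ {b} u → b ≢ a → E (b , u) ≡ D (b , u)

replaceLayer : ∀ {n ns} → Distribution (n ∷ ns) → Fin n → Distribution ns → Distribution (n ∷ ns)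
replaceLayer D a F (b , u) with b Fin.≟ a
... | yes _ = F u
... | no _  = D (b , u)

replaceLayer-same : ∀ {n ns} (D : Distribution (n ∷ ns)) a F u → replaceLayer D a F (a , u) ≡ F u
replaceLayer-same D a F u with a Fin.≟ a
... | yes _  = refl
... | no a≢a = ⊥-elim (a≢a refl)

replaceLayer-other : ∀ {n ns} (D : Distribution (n ∷ ns)) {a} F {b} u → b ≢ a →
  replaceLayer D a F (b , u) ≡ D (b , u)
replaceLayer-other D {a} F {b} u b≢a with b Fin.≟ a
... | yes b≡a = ⊥-elim (b≢a b≡a)
... | no _    = refl

replaceLayer-id : ∀ {n ns} (D : Distribution (n ∷ ns)) a → D ≗ replaceLayer D a (λ u → D (a , u))
replaceLayer-id D a (b , u) with b Fin.≟ a
... | yes refl = refl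
... | no _     = refl

lift-move : ∀ n ns (D : Distribution (n ∷ ns)) a {F F'} →
  Move ns F F' → Move (n ∷ ns) (replaceLayer D a F) (replaceLayer D a F')
lift-move n ns D a {F} {F'} (u , x , adj , Fu≡2+F'u , F'x≡1+Fx , unchanged) =
  (a , u) , (a , x) , inj₂ (refl , adj) ,
  trans (replaceLayer-same D a F u) (trans Fu≡2+F'u (cong (_+_ 2) (sym (replaceLayer-same D a F' u)))) ,
  trans (replaceLayer-same D a F' x) (trans F'x≡1+Fx (cong suc (sym (replaceLayer-same D a F x)))) ,
  unchanged′
  where
  unchanged′ : ∀ w → w ≢ (a , u) → w ≢ (a , x) → replaceLayer D a F' w ≡ replaceLayer D a F w
  unchanged′ (b , w) w≢au w≢ax with b Fin.≟ a
  ... | yes refl = unchanged w (w≢au ∘ cong (a ,_)) (w≢ax ∘ cong (a ,_))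
  ... | no _     = refl

lift-reachable : ∀ n ns (D : Distribution (n ∷ ns)) a {F F'} →
  Reachable ns F F' → Reachable (n ∷ ns) (replaceLayer D a F) (replaceLayer D a F')
lift-reachable n ns D a ε       = ε
lift-reachable n ns D a (m ◅ r) = lift-move n ns D a m ◅ lift-reachable n ns D a r

⇝-inLayer : ∀ n ns (D : Distribution (n ∷ ns)) a {k v} →
  ns ⊢ (λ u → D (a , u)) ⇝ (λ F → k ≤ F v) →
  (n ∷ ns) ⊢ D ⇝ (λ E → k ≤ E (a , v) × KeepsOtherLayers a D E)
⇝-inLayer n ns D a {k} {v} (F' , layer⇒F' , k≤F'v) with
  reachable-respˡ (n ∷ ns) (sym ∘ replaceLayer-id D a) (lift-reachable n ns D a layer⇒F')
... | E , D⇒E , E≗ =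
  E , D⇒E ,
  ≤-trans k≤F'v (≤-reflexive (sym (trans (E≗ (a , v)) (replaceLayer-same D a F' v)))) ,
  λ u b≢a → trans (E≗ (_ , u)) (replaceLayer-other D F' u b≢a)

gather : ∀ n ns K k (c : Fin n) (v : Vertex ns) →
  (∀ a {D : Distribution (n ∷ ns)} → (∀ u → K ≤ D (a , u)) →
     (n ∷ ns) ⊢ D ⇝ (λ E → 2 * k ≤ E (a , v) × KeepsOtherLayers a D E)) →
  ∀ j (h : Fin j → Fin n) → Injective _≡_ _≡_ h → (∀ i → h i ≢ c) →
  ∀ {D} → (∀ i u → K ≤ D (h i , u)) → (n ∷ ns) ⊢ D ⇝ (λ E → j * k + D (c , v) ≤ E (c , v))
gather n ns K k c v raise zero    h h-inj h≢c enough = ⇝-here ≤-refl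
gather n ns K k c v raise (suc j) h h-inj h≢c {D} enough =
  ⇝-bind (raise (h zero) (enough zero)) λ {E₁} (2k≤ , unchanged) →
  ⇝-bind (transfer (n ∷ ns) k (inj₁ (h≢c zero , refl)) 2k≤) λ {E₂} (k+E₁≤ , grown) →
  ⇝-map (λ {E₃} j*k+E₂≤ → begin
      (k + j * k) + D (c , v)       ≡⟨ cong (_+ D (c , v)) (+-comm k (j * k)) ⟩
      (j * k + k) + D (c , v)       ≡⟨ +-assoc (j * k) k (D (c , v)) ⟩
      j * k + (k + D (c , v))       ≡⟨ cong (λ x → j * k + (k + x)) (unchanged v (h≢c zero ∘ sym)) ⟨
      j * k + (k + E₁ (c , v))      ≤⟨ +-monoʳ-≤ (j * k) k+E₁≤ ⟩
      j * k + E₂ (c , v)            ≤⟨ j*k+E₂≤ ⟩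
      E₃ (c , v)                    ∎)
    (gather n ns K k c v raise j (h ∘ suc) (Fin.suc-injective ∘ h-inj) (h≢c ∘ suc)
       (λ i u → ≤-trans (enough (suc i) u)
                 (≤-trans (≤-reflexive (sym (unchanged u (other i))))
                          (grown _ (other i ∘ cong proj₁)))))
  where
  open ≤-Reasoning
  other : ∀ i → h (suc i) ≢ h zero
  other i = Fin.0≢1+n ∘ sym ∘ h-inj

uniform-reaches : ∀ ns m (v : Vertex ns) {D} → (∀ w → 2 ^ length ns * m ≤ D w) →
  ns ⊢ D ⇝ (λ E → m * productSuc ns ≤ E v)
uniform-reaches []            m tt       enough =
  ⇝-here (≤-trans (≤-reflexive (trans (*-identityʳ m) (sym (*-identityˡ m)))) (enough tt))
uniform-reaches (zero ∷ ns)   m (() , _)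
uniform-reaches (suc n₀ ∷ ns) m (c , v) {D} enough =
  ⇝-bind (raise c (λ u → enough′ (c , u))) λ {E₁} (2k≤ , unchanged) →
  ⇝-map (λ {E₂} n₀k+E₁≤ → begin
      m * (suc (suc n₀) * P)    ≡⟨ count n₀ m P ⟩
      n₀ * k + 2 * k           ≤⟨ +-monoʳ-≤ (n₀ * k) 2k≤ ⟩
      n₀ * k + E₁ (c , v)      ≤⟨ n₀k+E₁≤ ⟩
      E₂ (c , v)               ∎)
    (gather (suc n₀) ns K k c v raise n₀ (punchIn c) (Fin.punchIn-injective c _ _) (Fin.punchInᵢ≢i c)
       (λ i u → ≤-trans (enough′ (_ , u)) (≤-reflexive (sym (unchanged u (Fin.punchInᵢ≢i c i))))))
  where
  open ≤-Reasoning
  P = productSuc ns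
  k = m * P
  K = 2 ^ length ns * (2 * m)
  count : ∀ n₀ m P → m * (suc (suc n₀) * P) ≡ n₀ * (m * P) + 2 * (m * P)
  count = solve-∀
  enough′ : ∀ w → K ≤ D w
  enough′ w = ≤-trans (≤-reflexive (trans (x∙yz≈y∙xz (2 ^ length ns) 2 m) (sym (*-assoc 2 (2 ^ length ns) m))))
                      (enough w)
  raise : ∀ a {D : Distribution (suc n₀ ∷ ns)} → (∀ u → K ≤ D (a , u)) →
    (suc n₀ ∷ ns) ⊢ D ⇝ (λ E → 2 * k ≤ E (a , v) × KeepsOtherLayers a D E)
  raise a {D} enough-a = ⇝-map (map₁ (≤-trans (≤-reflexive (sym (*-assoc 2 m P)))))
    (⇝-inLayer (suc n₀) ns D a (uniform-reaches ns (2 * m) v enough-a))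

uniform : ∀ ns → ℕ → Distribution ns
uniform ns m _ = 2 ^ length ns * m

size-uniform : ∀ ns m → size ns (uniform ns m) ≡ 2 ^ length ns * m * product ns
size-uniform ns m = trans (size≡∑V ns _) (trans (∑V-const ns _) (*-comm (product ns) _))

uniform-solvable : ∀ ns {t} m → t ≤ m * productSuc ns → Solvable ns t (uniform ns m)
uniform-solvable ns m t≤ v = ⇝-map (≤-trans t≤) (uniform-reaches ns m v (λ _ → ≤-refl))

Searchable : Set → Set₁
Searchable A = ∀ {P : A → Set} → Decidable P → Dec (∃ P)

all? : ∀ {A : Set} → Searchable A → ∀ {P : A → Set} → Decidable P → Dec (∀ a → P a)
all? search P? = map′
  (λ no-counterexample a → decidable-stable (P? a) (λ ¬Pa → no-counterexample (a , ¬Pa)))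
  (λ all (a , ¬Pa) → ¬Pa (all a))
  (¬? (search (¬? ∘ P?)))

Fin-searchable : ∀ {n} → Searchable (Fin n)
Fin-searchable = Fin.any?

×-searchable : ∀ {A B : Set} → Searchable A → Searchable B → Searchable (A × B)
×-searchable searchA searchB P? = map′
  (λ (a , b , p) → (a , b) , p)
  (λ ((a , b) , p) → a , b , p)
  (searchA (λ a → searchB (λ b → P? (a , b))))

Vertex-searchable : ∀ ns → Searchable (Vertex ns)
Vertex-searchable []       P? = map′ (tt ,_) proj₂ (P? tt)
Vertex-searchable (n ∷ ns) = ×-searchable Fin-searchable (Vertex-searchable ns)

Vec-searchable : ∀ {A : Set} → Searchable A → ∀ n → Searchable (Vec A n)
Vec-searchable searchA zero    P? = map′ ([] ,_) (λ { ([] , p) → p }) (P? [])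
Vec-searchable searchA (suc n) P? = map′
  (λ (x , xs , p) → x ∷ xs , p)
  (λ { (x ∷ xs , p) → x , xs , p })
  (searchA (λ x → Vec-searchable searchA n (λ xs → P? (x ∷ xs))))

module _ ns {P : Distribution ns → Set} (P-resp : P Respects _≗_) (P? : Decidable P) where

  private
    FirstMove : Distribution ns → Vertex ns × Vertex ns → Set
    FirstMove D (x , y) = Adj ns x y × 2 ≤ D x × ns ⊢ step D x y ⇝ P

    first-move : ∀ {D} → ¬ P D → ns ⊢ D ⇝ P → ∃ (FirstMove D)
    first-move ¬PD (E , ε , PE) = ⊥-elim (¬PD PE)
    first-move ¬PD (E , m@(u , x , adj , Du≡2+Xu , _) ◅ X⇒E , PE)
      with reachable-respˡ ns (move≗step ns m) X⇒E
    ... | E′ , step⇒E′ , E′≗E =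
      (u , x) , adj , ≤-trans (m≤m+n 2 _) (≤-reflexive (sym Du≡2+Xu)) ,
      E′ , step⇒E′ , P-resp (sym ∘ E′≗E) PE

    -- Each move loses a pebble, so the size of D bounds the length of every sequence of moves.
    reaches?-fuel : ∀ f D → ∑V ns D ≤ f → Dec (ns ⊢ D ⇝ P)
    first-move? : ∀ f D → ∑V ns D ≤ f → Decidable (FirstMove D)

    reaches?-fuel f D ∑D≤f with P? D
    ... | yes PD  = yes (⇝-here PD)
    ... | no ¬PD  = map′
      (λ (_ , adj , 2≤Dx , reach) → ⇝-move (step-move ns adj 2≤Dx) reach)
      (first-move ¬PD)
      (×-searchable (Vertex-searchable ns) (Vertex-searchable ns) (first-move? f D ∑D≤f))

    first-move? f D ∑D≤f (x , y) with Adj? ns x y | 2 ≤? D x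
    ... | no ¬adj | _        = no (¬adj ∘ proj₁)
    ... | yes _   | no ¬2≤Dx = no (¬2≤Dx ∘ proj₁ ∘ proj₂)
    first-move? zero    D ∑D≤0 (x , y) | yes adj | yes 2≤Dx =
      ⊥-elim (2≰0 (≤-trans 2≤Dx (≤-trans (f≤∑V ns D x) ∑D≤0)))
      where
      2≰0 : ¬ 2 ≤ 0
      2≰0 ()
    first-move? (suc f) D ∑D≤1+f (x , y) | yes adj | yes 2≤Dx =
      map′ (λ reach → adj , 2≤Dx , reach) (proj₂ ∘ proj₂) (reaches?-fuel f (step D x y) ∑step≤f)
      where
      ∑step≤f : ∑V ns (step D x y) ≤ f
      ∑step≤f = ≤-pred (≤-trans (≤-reflexive (∑V-move ns (step-move ns adj 2≤Dx))) ∑D≤1+f)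

  reaches? : ∀ D → Dec (ns ⊢ D ⇝ P)
  reaches? D = reaches?-fuel (∑V ns D) D ≤-refl

solvable? : ∀ ns t → Decidable (Solvable ns t)
solvable? ns t D = all? (Vertex-searchable ns) λ v →
  reaches? ns (λ E≗E′ t≤Ev → ≤-trans t≤Ev (≤-reflexive (E≗E′ v))) (λ E → t ≤? E v) D

solvable-resp : ∀ ns t {D D'} → D ≗ D' → Solvable ns t D → Solvable ns t D'
solvable-resp ns t {D} {D'} D≗D' solvable v with solvable v
... | E , D⇒E , t≤Ev with reachable-respˡ ns D≗D' D⇒E
...   | E′ , D'⇒E′ , E′≗E = E′ , D'⇒E′ , ≤-trans t≤Ev (≤-reflexive (sym (E′≗E v)))

-- A distribution with all values ≤ p is encoded as a table of Fin (suc p) values: tables form a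
-- searchable type, whereas functions on vertices would need extensionality.
Table : List ℕ → Set → Set
Table []       A = A
Table (n ∷ ns) A = Vec (Table ns A) n

lookupTable : ∀ {A : Set} ns → Table ns A → Vertex ns → A
lookupTable []       x tt      = x
lookupTable (n ∷ ns) T (a , v) = lookupTable ns (Vec.lookup T a) v

tabulateTable : ∀ {A : Set} ns → (Vertex ns → A) → Table ns A
tabulateTable []       f = f tt
tabulateTable (n ∷ ns) f = Vec.tabulate (λ a → tabulateTable ns (λ v → f (a , v)))

lookup∘tabulateTable : ∀ {A : Set} ns (f : Vertex ns → A) → lookupTable ns (tabulateTable ns f) ≗ f
lookup∘tabulateTable []       f tt      = refl
lookup∘tabulateTable (n ∷ ns) f (a , v) =
  trans (cong (λ T → lookupTable ns T v) (Vec.lookup∘tabulate _ a)) (lookup∘tabulateTable ns _ v)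

Table-searchable : ∀ {A : Set} ns → Searchable A → Searchable (Table ns A)
Table-searchable []       searchA = searchA
Table-searchable (n ∷ ns) searchA = Vec-searchable (Table-searchable ns searchA) n

size-cong : ∀ ns {D D' : Distribution ns} → D ≗ D' → size ns D ≡ size ns D'
size-cong ns D≗D' = cong List.sum (List.map-cong D≗D' (allVertices ns))

≤size : ∀ ns (D : Distribution ns) w → D w ≤ size ns D
≤size ns D w = ≤-trans (f≤∑V ns D w) (≤-reflexive (sym (size≡∑V ns D)))

SolvableOfSize : ∀ ns → ℕ → ℕ → Set
SolvableOfSize ns t p = ∃[ D ] (Solvable ns t D × size ns D ≡ p)

solvableOfSize? : ∀ ns t → Decidable (SolvableOfSize ns t)
solvableOfSize? ns t p = map′
  (λ (T , solvable , size≡p) → _ , solvable , size≡p)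
  (λ (D , solvable , size≡p) → table D size≡p , solvable-resp ns t (table≗ D size≡p) solvable
                                              , trans (size-cong ns (sym ∘ table≗ D size≡p)) size≡p)
  (Table-searchable ns Fin-searchable λ T →
     solvable? ns t (toℕ ∘ lookupTable ns T) ×-dec size ns (toℕ ∘ lookupTable ns T) ≟ p)
  where
  table : ∀ D → size ns D ≡ p → Table ns (Fin (suc p))
  table D size≡p = tabulateTable ns (λ w → fromℕ< (s≤s (≤-trans (≤size ns D w) (≤-reflexive size≡p))))
  table≗ : ∀ D (size≡p : size ns D ≡ p) → D ≗ toℕ ∘ lookupTable ns (table D size≡p)
  table≗ D size≡p w = sym (trans (cong toℕ (lookup∘tabulateTable ns _ w)) (Fin.toℕ-fromℕ< _))

least : ∀ {P : ℕ → Set} → Decidable P → ∀ {b} → P b → ∃[ p ] (P p × ∀ q → P q → p ≤ q)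
least {P} P? {b} Pb = below b b ≤-refl Pb
  where
  below : ∀ b q → q ≤ b → P q → ∃[ p ] (P p × ∀ q → P q → p ≤ q)
  below b q q≤b Pq with anyUpTo? P? q
  ... | no nothing-below = q , Pq , λ r Pr → ≮⇒≥ (λ r<q → nothing-below (r , r<q , Pr))
  below (suc b) q q≤b Pq | yes (r , r<q , Pr) = below b r (≤-pred (≤-trans r<q q≤b)) Pr
  below zero    q q≤0 Pq | yes (r , r<q , Pr) = ⊥-elim (<⇒≱ (≤-trans r<q q≤0) z≤n)

productSuc≢0 : ∀ ns → NonZero (productSuc ns)
productSuc≢0 ns = product≢0 (All.map⁺ (All.universal (λ _ → _) ns))

roundUpToMultiple : ∀ t n .{{_ : NonZero n}} → ∃[ m ] (t ≤ m * n × m * n ≤ t + n)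
roundUpToMultiple t n = suc (t / n) , t≤ , ≤-trans (+-monoʳ-≤ n (m/n*n≤m t n)) (≤-reflexive (+-comm n t))
  where
  t≤ : t ≤ suc (t / n) * n
  t≤ = begin
    t                   ≡⟨ m≡m%n+[m/n]*n t n ⟩
    t % n + t / n * n   ≤⟨ +-monoˡ-≤ (t / n * n) (m%n≤n t n) ⟩
    n + t / n * n       ∎
    where open ≤-Reasoning

optimal-exists : ∀ ns t → ∃[ p ] IsOptPebbling ns t p
optimal-exists ns t with roundUpToMultiple t (productSuc ns) {{productSuc≢0 ns}}
... | m , t≤m*P , _ with least (solvableOfSize? ns t) (uniform ns m , uniform-solvable ns m t≤m*P , refl)
...   | p , solvableOfSize , minimal = p , solvableOfSize , λ D solvable → minimal (size ns D) (D , solvable , refl)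

∣m-n∣≤o : ∀ {m n o} → n ≤ m → m ≤ n + o → ∣ + m - + n ∣ ≤ o
∣m-n∣≤o {m} {n} n≤m m≤n+o =
  ≤-trans (≤-reflexive (cong ∣_∣ (trans (ℤ.m-n≡m⊖n m n) (ℤ.⊖-≥ n≤m)))) (m≤n+o⇒m∸n≤o m n m≤n+o)

optimal-lowerBound : ∀ ns {t p} → IsOptPebbling ns t p → 2 ^ length ns * t * product ns ≤ productSuc ns * p
optimal-lowerBound ns ((D , solvable , refl) , _) = solvable⇒size-lowerBound ns _ solvable

optimal-upperBound : ∀ ns {t p} → IsOptPebbling ns t p →
  productSuc ns * p ≤ 2 ^ length ns * t * product ns + 2 ^ length ns * product ns * productSuc ns
optimal-upperBound ns {t} {p} (_ , minimal) with roundUpToMultiple t (productSuc ns) {{productSuc≢0 ns}}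
... | m , t≤m*P , m*P≤t+P = begin
  P * p                                     ≤⟨ *-monoʳ-≤ P (minimal _ (uniform-solvable ns m t≤m*P)) ⟩
  P * size ns (uniform ns m)                ≡⟨ cong (_*_ P) (size-uniform ns m) ⟩
  P * (2 ^ length ns * m * product ns)      ≡⟨ rearrange P (2 ^ length ns) m (product ns) ⟩
  C * (m * P)                               ≤⟨ *-monoʳ-≤ C m*P≤t+P ⟩
  C * (t + P)                               ≡⟨ expand (2 ^ length ns) (product ns) t P ⟩
  2 ^ length ns * t * product ns + C * P    ∎
  where
  open ≤-Reasoning
  P = productSuc ns
  C = 2 ^ length ns * product ns
  rearrange : ∀ P x m q → P * (x * m * q) ≡ x * q * (m * P)
  rearrange = solve-∀
  expand : ∀ x q t P → x * q * (t + P) ≡ x * t * q + x * q * P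
  expand = solve-∀

theorem3p15 : (ns : List ℕ) → 1 ≤ length ns → All (0 <_) ns →
    (∀ t → ∃[ p ] IsOptPebbling ns t p) ×
    (∃[ C ] (∀ t p → IsOptPebbling ns t p →
      ∣ + (productSuc ns * p) - + (2 ^ length ns * t * product ns) ∣ ≤ C * productSuc ns))
theorem3p15 ns _ _ =
  optimal-exists ns ,
  2 ^ length ns * product ns ,
  λ t p opt → ∣m-n∣≤o (optimal-lowerBound ns opt) (optimal-upperBound ns opt)
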